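{- Let $G$ be a connected simple graph containing a vertex $a$ with $d_G(a)\geq 2$, fix any execution of Algorithm $\text{tree}(G)$, and let $r$ and $U$ be the rank function and set of uniquely-ranked vertices associated with this execution (as defined in the context). If $uvw$ is a path of $G$ with $\{u,v\}\subseteq U$ and $r(u)<r(v)<r(w)$, then $d_G(v)=2$.
   Context: All graphs are finite, undirected and simple. For a graph $H$ and $u\in V(H)$, $d_H(u)$ is the number of neighbors of $u$ in $H$. For a tree $T$ that is a subgraph of $G$ and $u\in V(T)$, let $V_T(u)$ be the set of vertices $v\in V(G)\setminus V(T)$ with $uv\in E(G)$, and $E_T(u)=\{uv:v\in V_T(u)\}$; if $|V_T(u)|=1$, let $v_T(u)$ be its unique element. $T\cup E_T(u)$ is the tree obtained by adding the vertices $V_T(u)$ and edges $E_T(u)$ ("expanding $T$ at $u$"). $W_2(T)$ is the set of $u\in V(T)$ with $|V_T(u)|\geq 2$; $W_1(T)$ is the set of $u\in V(T)$ with $|V_T(u)|=1$ and $|V_{T\cup E_T(u)}(v_T(u))|\geq 2$; $W_0(T)$ is the set of $u\in V(T)$ with $|V_T(u)|=1$ and $|V_{T\cup E_T(u)}(v_T(u))|\leq 1$. Algorithm $\text{tree}(G)$: start with $T=\{a\}$; while $V(T)\neq V(G)$: if $W_2(T)\neq\varnothing$ let $u$ be an arbitrary vertex of $W_2(T)$; else if $W_1(T)\neq\varnothing$ let $u$ be an arbitrary vertex of $W_1(T)$; else let $u$ be the vertex of $W_0(T)$ that joined $V(T)$ most recently; then set $T:=T\cup E_T(u)$. Return $T$.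 For a fixed execution, let $T$ be the returned spanning tree, rooted at $a$, and for $v\neq a$ let $p(v)$ be the parent of $v$ in $T$. For each vertex $u$ at which the algorithm expands the tree, let $T_u$ be the current tree immediately before that expansion (so $u=p(v)$ iff $v\in V_{T_u}(u)$). Define ranks $r:V(G)\to\mathbb{Z}$ by $r(a)=1$ and, for each edge $uv$ of $T$ with $u=p(v)$: $r(v)=r(u)$ if $u\in W_2(T_u)$, and $r(v)=1+\max_{w\in V(T_u)} r(w)$ otherwise. Let $U$ be the set of vertices $v$ of $G$ such that no other vertex of $G$ has rank $r(v)$. -}

module Defs where

open import Data.Nat using (ℕ; zero; suc; _≤_; _⊔_; _≤?_)
open import Data.Bool using (Bool; true; false; _∧_; _∨_; not; if_then_else_)
open import Data.Fin using (Fin)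
open import Data.Fin.Subset using (∣_∣)
open import Data.Vec using (tabulate)
open import Data.List using (List; foldr; map)
open import Data.List using () renaming (_∷_ to _∷ₗ_)
open import Data.Fin.Base using () 
open import Data.Product using (Σ; ∃; _×_; _,_)
open import Data.Sum using (_⊎_)
open import Relation.Nullary using (¬_; yes; no)
open import Relation.Binary.PropositionalEquality using (_≡_; _≢_)
import Data.List as L

record Graph (n : ℕ) : Set where
  field
    adj    : Fin n → Fin n → Bool
    sym    : ∀ u v → adj u v ≡ adj v u
    irrefl : ∀ u → adj u u ≡ false
open Graph public

Edge : ∀ {n} → Graph n → Fin n → Fin n → Set
Edge G u v = adj G u v ≡ true

deg : ∀ {n} → Graph n → Fin n → ℕ
deg G u = ∣ tabulate (adj G u) ∣

data Reach {n} (G : Graph n) (u : Fin n) : Fin n → Set where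
  here  : Reach G u u
  there : ∀ {v w} → Reach G u v → Edge G v w → Reach G u w

Connected : ∀ {n} → Graph n → Set
Connected G = ∀ u v → Reach G u v

-- States of algorithm tree(G)
-- inT  : membership in V(T)
-- time : the expansion step at which a vertex joined V(T) (a: 0)
-- rank : the rank r of a vertex (meaningful for vertices of T)

record State (n : ℕ) : Set where
  field
    inT  : Fin n → Bool
    time : Fin n → ℕ
    rank : Fin n → ℕ
open State public

init : ∀ {n} → Fin n → State n
init {n} a = record
  { inT  = λ v → isA v
  ; time = λ _ → 0
  ; rank = λ _ → 1 }
  where
  open import Data.Fin using (_≟_)
  isA : Fin n → Bool
  isA v with v ≟ a
  ... | yes _ = true
  ... | no  _ = false

module _ {n : ℕ} (G : Graph n) where

  new : State n → Fin n → Fin n → Bool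
  new T u v = adj G u v ∧ not (inT T v)

  cnt : State n → Fin n → ℕ
  cnt T u = ∣ tabulate (new T u) ∣

  maxRank : State n → ℕ
  maxRank T = foldr _⊔_ 0 (map (λ w → if inT T w then rank T w else 0) (L.allFin n))

  newRank : State n → Fin n → ℕ
  newRank T u with 2 ≤? cnt T u
  ... | yes _ = rank T u
  ... | no  _ = suc (maxRank T)

  -- T ∪ E_T(u), performed as the k-th expansion (k ≥ 1)
  expand : ℕ → State n → Fin n → State n
  expand k T u = record
    { inT  = λ v → inT T v ∨ adj G u v
    ; time = λ v → if new T u v then k else time T v
    ; rank = λ v → if new T u v then newRank T u else rank T v }

  W2 : State n → Fin n → Set
  W2 T u = inT T u ≡ true × 2 ≤ cnt T u

  W1 : State n → Fin n → Set
  W1 T u = inT T u ≡ true × cnt T u ≡ 1 ×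
           (∀ v → new T u v ≡ true → 2 ≤ cnt (expand 0 T u) v)

  W0 : State n → Fin n → Set
  W0 T u = inT T u ≡ true × cnt T u ≡ 1 ×
           (∀ v → new T u v ≡ true → cnt (expand 0 T u) v ≤ 1)

  -- the selection rule of tree(G)
  -- (in the W_0 case: u joined V(T) most recently among W_0(T); vertices
  --  that joined in the same expansion may be ordered arbitrarily)
  Choice : State n → Fin n → Set
  Choice T u =
      W2 T u
    ⊎ ((¬ ∃ λ w → W2 T w) × W1 T u)
    ⊎ ((¬ ∃ λ w → W2 T w) × (¬ ∃ λ w → W1 T w) × W0 T u ×
       (∀ w → W0 T w → time T w ≤ time T u))

  data Run (a : Fin n) : State n → ℕ → Set where
    start : Run a (init a) 0
    next  : ∀ {T k} → Run a T k →
            (∃ λ w → inT T w ≡ false) →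
            (u : Fin n) → Choice T u →
            Run a (expand (suc k) T u) (suc k)

  Complete : State n → Set
  Complete T = ∀ v → inT T v ≡ true

  InU : State n → Fin n → Set
  InU T v = ∀ w → w ≢ v → rank T w ≢ rank T v

-- The case u = a is impossible: d(a) ≥ 2 puts a into W₂ at the first step, so
-- a shares its rank with its children. Otherwise u joins the tree when the
-- algorithm expands some p₀ in a state S₀. If p₀ ∈ W₂(S₀), u again shares a
-- rank; so W₂(S₀) = ∅, u is the only new vertex and gets a new maximal rank,
-- and v and w, of larger rank, are still outside. A uniquely ranked vertex is
-- never expanded from W₂, hence W₂ stays empty and u has the single outside
-- neighbour v. Then W₁(S₀) = ∅ (else p₀ ∈ W₁ would give u two outside
-- neighbours), no vertex of S₀ can be in W₁ later, and u, in W₀ and the most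
-- recent vertex, is expanded next. The same argument at v shows that v has at
-- most one outside neighbour when it is attached, and a neighbour of v in S₀
-- would have been in W₁(S₀) (v sees both u and w outside). So N(v) = {u, w}.
module Submission where

open import Defs hiding (sym)
open import Data.Nat using (ℕ; suc; _≤_; _<_; _+_; _⊔_; z≤n; s≤s; _≤?_)
open import Data.Nat.Properties
  using (≤-refl; ≤-reflexive; ≤-trans; ≤-antisym; ≤-pred; ≰⇒>; ≤⇒≯; <⇒≱; <⇒≢; <-trans;
         1+n≰n; n≤1+n; m≤n⇒m≤1+n; +-suc; +-monoʳ-≤; m≤n⇒m≤n⊔o; m≤n⇒m≤o⊔n; module ≤-Reasoning)
open import Data.Bool using (Bool; true; false; _∨_; if_then_else_)
open import Data.Bool.Properties using (∧-zeroʳ; ∨-zeroʳ; not-¬; ¬-not)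
open import Data.Fin using (Fin; _≟_)
open import Data.Fin.Subset using (Subset; inside; outside; _∈_; _⊆_; _∪_; ⁅_⁆; ∣_∣; Nonempty)
open import Data.Fin.Subset.Properties
  using (p⊆q⇒∣p∣≤∣q∣; ∣p∣≤∣x∷p∣; ∣⁅x⁆∣≡1; ∣⊥∣≡0; x∈⁅y⁆⇒x≡y; x∈⁅y⁆⇔x≡y; x∈p∪q⁺;
         x∈p∧x≢y⇒x∈p-y; x∈p⇒∣p-x∣<∣p∣; nonempty?; Empty-unique)
open import Data.Vec using (tabulate; _∷_; [])
open import Data.Vec.Properties using (lookup∘tabulate; lookup⇒[]=; []=⇒lookup)
open import Data.List.Properties using (foldr-preservesᵒ)
import Data.List.Relation.Unary.Any as Any
open import Data.List.Relation.Unary.Any.Properties using (map⁺)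
open import Data.List.Membership.Propositional.Properties using (∈-allFin)
open import Data.Empty using (⊥-elim)
open import Data.Product using (∃; ∃-syntax; _×_; _,_; proj₁; proj₂)
open import Data.Sum using (_⊎_; inj₁; inj₂; [_,_]; fromInj₁)
import Data.Sum as Sum
open import Function.Bundles using (module Equivalence)
open Equivalence using (from)
open import Relation.Nullary using (¬_; yes; no; contradiction)
open import Relation.Binary.PropositionalEquality
  using (_≡_; _≢_; refl; sym; trans; cong; cong₂; subst; ≢-sym; module ≡-Reasoning)

¬2≤⇒≤1 : ∀ {m} → ¬ 2 ≤ m → m ≤ 1
¬2≤⇒≤1 ¬2≤m = ≤-pred (≰⇒> ¬2≤m)

∣p∪q∣≤∣p∣+∣q∣ : ∀ {n} (p q : Subset n) → ∣ p ∪ q ∣ ≤ ∣ p ∣ + ∣ q ∣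
∣p∪q∣≤∣p∣+∣q∣ []            []            = z≤n
∣p∪q∣≤∣p∣+∣q∣ (inside  ∷ p) (x ∷ q)       =
  s≤s (≤-trans (∣p∪q∣≤∣p∣+∣q∣ p q) (+-monoʳ-≤ ∣ p ∣ (∣p∣≤∣x∷p∣ x q)))
∣p∪q∣≤∣p∣+∣q∣ (outside ∷ p) (inside  ∷ q) =
  subst (suc ∣ p ∪ q ∣ ≤_) (sym (+-suc ∣ p ∣ ∣ q ∣)) (s≤s (∣p∪q∣≤∣p∣+∣q∣ p q))
∣p∪q∣≤∣p∣+∣q∣ (outside ∷ p) (outside ∷ q) = ∣p∪q∣≤∣p∣+∣q∣ p q

module _ {n : ℕ} {f : Fin n → Bool} {x : Fin n} where

  ∈-tabulate⁺ : f x ≡ true → x ∈ tabulate f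
  ∈-tabulate⁺ fx = lookup⇒[]= x (tabulate f) (trans (lookup∘tabulate f x) fx)

  ∈-tabulate⁻ : x ∈ tabulate f → f x ≡ true
  ∈-tabulate⁻ x∈ = trans (sym (lookup∘tabulate f x)) ([]=⇒lookup x∈)

module _ {n : ℕ} where

  x∈p⇒1≤∣p∣ : ∀ {p : Subset n} {x} → x ∈ p → 1 ≤ ∣ p ∣
  x∈p⇒1≤∣p∣ {p} {x} x∈p = subst (_≤ ∣ p ∣) (∣⁅x⁆∣≡1 x) (p⊆q⇒∣p∣≤∣q∣ ⁅x⁆⊆p)
    where
    ⁅x⁆⊆p : ⁅ x ⁆ ⊆ p
    ⁅x⁆⊆p y∈⁅x⁆ = subst (_∈ p) (sym (x∈⁅y⁆⇒x≡y x y∈⁅x⁆)) x∈p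

  1≤∣p∣⇒nonempty : ∀ {p : Subset n} → 1 ≤ ∣ p ∣ → Nonempty p
  1≤∣p∣⇒nonempty {p} 1≤∣p∣ with nonempty? p
  ... | yes ne = ne
  ... | no ¬ne with subst (1 ≤_) (trans (cong ∣_∣ (Empty-unique ¬ne)) (∣⊥∣≡0 n)) 1≤∣p∣
  ...   | ()

  x≢y∈p⇒2≤∣p∣ : ∀ {p : Subset n} {x y} → x ∈ p → y ∈ p → x ≢ y → 2 ≤ ∣ p ∣
  x≢y∈p⇒2≤∣p∣ x∈p y∈p x≢y =
    ≤-trans (s≤s (x∈p⇒1≤∣p∣ (x∈p∧x≢y⇒x∈p-y x∈p x≢y))) (x∈p⇒∣p-x∣<∣p∣ y∈p)

  ∣p∣≤1⇒x≡y : ∀ {p : Subset n} → ∣ p ∣ ≤ 1 → ∀ {x y} → x ∈ p → y ∈ p → x ≡ y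
  ∣p∣≤1⇒x≡y ∣p∣≤1 {x} {y} x∈p y∈p with x ≟ y
  ... | yes x≡y = x≡y
  ... | no x≢y = contradiction (x≢y∈p⇒2≤∣p∣ x∈p y∈p x≢y) (≤⇒≯ ∣p∣≤1)

  p⊆⁅x⁆∪⁅y⁆⇒∣p∣≤2 : ∀ {p : Subset n} {x y} → p ⊆ ⁅ x ⁆ ∪ ⁅ y ⁆ → ∣ p ∣ ≤ 2
  p⊆⁅x⁆∪⁅y⁆⇒∣p∣≤2 {x = x} {y} p⊆ =
    ≤-trans (p⊆q⇒∣p∣≤∣q∣ p⊆)
      (≤-trans (∣p∪q∣≤∣p∣+∣q∣ ⁅ x ⁆ ⁅ y ⁆) (≤-reflexive (cong₂ _+_ (∣⁅x⁆∣≡1 x) (∣⁅x⁆∣≡1 y))))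

infix 4 _∈V_ _∉V_ _⊆V_

-- A record rather than the bare equation, so that the state is inferable from a membership proof.
record _∈V_ {n} (x : Fin n) (S : State n) : Set where
  constructor mk∈V
  field inT≡true : inT S x ≡ true
open _∈V_ public

_∉V_ : ∀ {n} → Fin n → State n → Set
x ∉V S = ¬ x ∈V S

_⊆V_ : ∀ {n} → State n → State n → Set
S ⊆V T = ∀ {x} → x ∈V S → x ∈V T

module _ {n : ℕ} {S : State n} {x : Fin n} where

  ∉V⇒inT≡false : x ∉V S → inT S x ≡ false
  ∉V⇒inT≡false x∉ = ¬-not (λ x∈ → x∉ (mk∈V x∈))

  inT≡false⇒∉V : inT S x ≡ false → x ∉V S
  inT≡false⇒∉V x∉ (mk∈V x∈) = not-¬ x∈ x∉

  ∈V-or-∉V : x ∈V S ⊎ x ∉V S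
  ∈V-or-∉V with inT S x in eq
  ... | true  = inj₁ (mk∈V eq)
  ... | false = inj₂ (inT≡false⇒∉V eq)

∈-init⇒≡ : ∀ {n} {a x : Fin n} → x ∈V init a → x ≡ a
∈-init⇒≡ {a = a} {x} (mk∈V x∈) with x ≟ a
... | yes x≡a = x≡a
... | no _ = contradiction x∈ λ ()

≢⇒∉-init : ∀ {n} {a x : Fin n} → x ≢ a → x ∉V init a
≢⇒∉-init {a = a} {x} x≢a (mk∈V x∈) with x ≟ a
... | yes x≡a = x≢a x≡a
... | no _ = contradiction x∈ λ ()

module _ {n : ℕ} (G : Graph n) where

  Fresh : State n → Fin n → Fin n → Set
  Fresh S p x = Edge G p x × x ∉V S

  NoW2 : State n → Set
  NoW2 S = ∀ {x} → x ∈V S → cnt G S x ≤ 1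

  NoW2Except : State n → Fin n → Set
  NoW2Except S u = ∀ {x} → x ∈V S → x ≢ u → cnt G S x ≤ 1

  edge-sym : ∀ {x y} → Edge G x y → Edge G y x
  edge-sym {x} {y} e = trans (Graph.sym G y x) e

  edge⇒≢ : ∀ {x y} → Edge G x y → x ≢ y
  edge⇒≢ {x} e refl = not-¬ e (irrefl G x)

  module _ {S : State n} {p x : Fin n} where

    fresh⇒new : Fresh S p x → new G S p x ≡ true
    fresh⇒new (e , x∉) rewrite e | ∉V⇒inT≡false x∉ = refl

    new⇒fresh : new G S p x ≡ true → Fresh S p x
    new⇒fresh nw with adj G p x | inT S x in eq
    new⇒fresh () | false | _
    new⇒fresh () | true  | true
    new⇒fresh _  | true  | false = refl , inT≡false⇒∉V eq

    ∈V⇒new≡false : x ∈V S → new G S p x ≡ false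
    ∈V⇒new≡false (mk∈V x∈) rewrite x∈ = ∧-zeroʳ (adj G p x)

    module _ {k : ℕ} where

      ∈-expand⁺ : x ∈V S → x ∈V expand G k S p
      ∈-expand⁺ (mk∈V x∈) = mk∈V (cong (_∨ adj G p x) x∈)

      edge⇒∈-expand : Edge G p x → x ∈V expand G k S p
      edge⇒∈-expand e = mk∈V (trans (cong (inT S x ∨_) e) (∨-zeroʳ (inT S x)))

      ∈-expand⁻ : x ∈V expand G k S p → x ∈V S ⊎ Fresh S p x
      ∈-expand⁻ (mk∈V x∈) with inT S x in eq | adj G p x
      ... | true  | _    = inj₁ (mk∈V eq)
      ... | false | true = inj₂ (refl , inT≡false⇒∉V eq)

      ∉-expand : x ∉V S → ¬ Edge G p x → x ∉V expand G k S p
      ∉-expand x∉ ¬e x∈ = [ x∉ , (λ fr → ¬e (proj₁ fr)) ] (∈-expand⁻ x∈)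

      rank-expand-fresh : Fresh S p x → rank (expand G k S p) x ≡ newRank G S p
      rank-expand-fresh fr rewrite fresh⇒new fr = refl

      rank-expand-old : x ∈V S → rank (expand G k S p) x ≡ rank S x
      rank-expand-old x∈ rewrite ∈V⇒new≡false x∈ = refl

      time-expand-fresh : Fresh S p x → time (expand G k S p) x ≡ k
      time-expand-fresh fr rewrite fresh⇒new fr = refl

      time-expand-old : x ∈V S → time (expand G k S p) x ≡ time S x
      time-expand-old x∈ rewrite ∈V⇒new≡false x∈ = refl

  module _ {S : State n} {p : Fin n} where

    newRank-W2 : 2 ≤ cnt G S p → newRank G S p ≡ rank S p
    newRank-W2 2≤c with 2 ≤? cnt G S p
    ... | yes _ = refl
    ... | no ¬2≤c = contradiction 2≤c ¬2≤c

    newRank-lonely : cnt G S p ≤ 1 → newRank G S p ≡ suc (maxRank G S)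
    newRank-lonely c≤1 with 2 ≤? cnt G S p
    ... | yes 2≤c = contradiction 2≤c (≤⇒≯ c≤1)
    ... | no _ = refl

  rank≤maxRank : ∀ {S x} → x ∈V S → rank S x ≤ maxRank G S
  rank≤maxRank {S} {x} (mk∈V x∈) =
    foldr-preservesᵒ {P = rank S x ≤_} {f = _⊔_} (λ m m′ → [ m≤n⇒m≤n⊔o m′ , m≤n⇒m≤o⊔n m ]) 0 _
      (inj₂ (map⁺ (Any.map (λ { refl → rank≤rankOf }) (∈-allFin x))))
    where
    rank≤rankOf : rank S x ≤ (if inT S x then rank S x else 0)
    rank≤rankOf rewrite x∈ = ≤-refl

  module _ {S : State n} {p : Fin n} where

    private
      V : Subset n
      V = tabulate (new G S p)

    fresh⇒1≤cnt : ∀ {x} → Fresh S p x → 1 ≤ cnt G S p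
    fresh⇒1≤cnt fr = x∈p⇒1≤∣p∣ {p = V} (∈-tabulate⁺ (fresh⇒new fr))

    1≤cnt⇒fresh : 1 ≤ cnt G S p → ∃ (Fresh S p)
    1≤cnt⇒fresh 1≤c =
      Data.Product.map₂ (λ x∈ → new⇒fresh (∈-tabulate⁻ x∈)) (1≤∣p∣⇒nonempty {p = V} 1≤c)

    fresh-unique : cnt G S p ≤ 1 → ∀ {x y} → Fresh S p x → Fresh S p y → x ≡ y
    fresh-unique c≤1 frx fry =
      ∣p∣≤1⇒x≡y {p = V} c≤1 (∈-tabulate⁺ (fresh⇒new frx)) (∈-tabulate⁺ (fresh⇒new fry))

    fresh≢⇒2≤cnt : ∀ {x y} → Fresh S p x → Fresh S p y → x ≢ y → 2 ≤ cnt G S p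
    fresh≢⇒2≤cnt frx fry =
      x≢y∈p⇒2≤∣p∣ {p = V} (∈-tabulate⁺ (fresh⇒new frx)) (∈-tabulate⁺ (fresh⇒new fry))

  fresh-⊆V : ∀ {S S′ p x} → S ⊆V S′ → Fresh S′ p x → Fresh S p x
  fresh-⊆V S⊆S′ (e , x∉) = e , (λ x∈ → x∉ (S⊆S′ x∈))

  cnt-antitone : ∀ {S S′ x} → S ⊆V S′ → cnt G S′ x ≤ cnt G S x
  cnt-antitone {S} {S′} {x} S⊆S′ =
    p⊆q⇒∣p∣≤∣q∣ {p = tabulate (new G S′ x)} {q = tabulate (new G S x)}
      (λ x∈ → ∈-tabulate⁺ (fresh⇒new (fresh-⊆V S⊆S′ (new⇒fresh (∈-tabulate⁻ x∈)))))

  expand-⊆V : ∀ {S S′ k k′ p} → S ⊆V S′ → expand G k S p ⊆V expand G k′ S′ p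
  expand-⊆V S⊆S′ x∈ =
    [ (λ x∈S → ∈-expand⁺ (S⊆S′ x∈S)) , (λ fr → edge⇒∈-expand (proj₁ fr)) ] (∈-expand⁻ x∈)

  deg≡2 : ∀ {v x y} → Edge G v x → Edge G v y → x ≢ y →
          (∀ {z} → Edge G v z → z ≡ x ⊎ z ≡ y) → deg G v ≡ 2
  deg≡2 {v} vx vy x≢y neighbours =
    ≤-antisym (p⊆⁅x⁆∪⁅y⁆⇒∣p∣≤2 {p = tabulate (adj G v)}
                 (λ z∈ → x∈p∪q⁺ (Sum.map (from x∈⁅y⁆⇔x≡y) (from x∈⁅y⁆⇔x≡y)
                                          (neighbours (∈-tabulate⁻ z∈)))))
              (x≢y∈p⇒2≤∣p∣ {p = tabulate (adj G v)} (∈-tabulate⁺ vx) (∈-tabulate⁺ vy) x≢y)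

  -- A segment of an execution, peeled from the front (Run grows at the back).
  data Steps : State n → ℕ → State n → ℕ → Set where
    done : ∀ {T k} → Steps T k T k
    step : ∀ {S j T k} (p : Fin n) → Choice G S p →
           Steps (expand G (suc j) S p) (suc j) T k → Steps S j T k

  steps-snoc : ∀ {S j T k} → Steps S j T k → (p : Fin n) → Choice G T p →
               Steps S j (expand G (suc k) T p) (suc k)
  steps-snoc done          p c = step p c done
  steps-snoc (step q c′ R) p c = step q c′ (steps-snoc R p c)

  run⇒steps : ∀ {a T k} → Run G a T k → Steps (init a) 0 T k
  run⇒steps start          = done
  run⇒steps (next R _ p c) = steps-snoc (run⇒steps R) p c

  steps-rank : ∀ {S j T k x} → Steps S j T k → x ∈V S → rank T x ≡ rank S x
  steps-rank done         x∈ = refl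
  steps-rank {j = j} (step p c R) x∈ =
    trans (steps-rank R (∈-expand⁺ {k = suc j} x∈)) (rank-expand-old {k = suc j} x∈)

  steps-proceed : ∀ {S j T k x} → Steps S j T k → x ∉V S → x ∈V T →
                  ∃[ p ] Choice G S p × Steps (expand G (suc j) S p) (suc j) T k
  steps-proceed done         x∉ x∈ = contradiction x∈ x∉
  steps-proceed (step p c R) _  _  = p , c , R

  time-bound : ∀ {a T k x} → Run G a T k → x ∈V T → time T x ≤ k
  time-bound start          _  = z≤n
  time-bound (next R _ p c) x∈ with ∈-expand⁻ x∈
  ... | inj₁ x∈T = ≤-trans (≤-reflexive (time-expand-old x∈T)) (m≤n⇒m≤1+n (time-bound R x∈T))
  ... | inj₂ fr  = ≤-reflexive (time-expand-fresh fr)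

  data Birth (a : Fin n) (T : State n) (k : ℕ) (x : Fin n) : Set where
    birth : ∀ {S j} (p : Fin n) → Run G a S j → Choice G S p → Fresh S p x →
            Steps (expand G (suc j) S p) (suc j) T k → Birth a T k x

  born : ∀ {a T k x} → Run G a T k → x ∈V T → x ≡ a ⊎ Birth a T k x
  born start          x∈ = inj₁ (∈-init⇒≡ x∈)
  born (next R _ p c) x∈ with ∈-expand⁻ x∈
  ... | inj₂ fr = inj₂ (birth p R c fr done)
  ... | inj₁ x∈T with born R x∈T
  ...   | inj₁ x≡a                   = inj₁ x≡a
  ...   | inj₂ (birth q R′ c′ fr R″) = inj₂ (birth q R′ c′ fr (steps-snoc R″ p c))

  -- The selection rule and unique ranks

  module _ {S : State n} {p : Fin n} where

    choice-∈ : Choice G S p → p ∈V S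
    choice-∈ (inj₁ (p∈ , _))                   = mk∈V p∈
    choice-∈ (inj₂ (inj₁ (_ , p∈ , _)))        = mk∈V p∈
    choice-∈ (inj₂ (inj₂ (_ , _ , (p∈ , _) , _))) = mk∈V p∈

    choice-W2 : Choice G S p → ∀ {q} → q ∈V S → 2 ≤ cnt G S q → 2 ≤ cnt G S p
    choice-W2 (inj₁ (_ , 2≤c))          _  _    = 2≤c
    choice-W2 (inj₂ (inj₁ (¬W2 , _)))   q∈ 2≤c = contradiction (_ , inT≡true q∈ , 2≤c) ¬W2
    choice-W2 (inj₂ (inj₂ (¬W2 , _)))   q∈ 2≤c = contradiction (_ , inT≡true q∈ , 2≤c) ¬W2

    lonely-choice⇒NoW2 : Choice G S p → cnt G S p ≤ 1 → NoW2 S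
    lonely-choice⇒NoW2 c c≤1 {x} x∈ with 2 ≤? cnt G S x
    ... | yes 2≤c = contradiction (choice-W2 c x∈ 2≤c) (≤⇒≯ c≤1)
    ... | no ¬2≤c = ¬2≤⇒≤1 ¬2≤c

    ∈-lonely-expand : ∀ {k u x} → cnt G S p ≤ 1 → Fresh S p u → x ∈V expand G k S p → x ∈V S ⊎ x ≡ u
    ∈-lonely-expand c≤1 fr x∈ = Sum.map₂ (λ frx → fresh-unique c≤1 frx fr) (∈-expand⁻ x∈)

    lonely-expand⇒NoW2Except : ∀ {k u} → NoW2 S → cnt G S p ≤ 1 → Fresh S p u →
                               NoW2Except (expand G k S p) u
    lonely-expand⇒NoW2Except {k} noW2 c≤1 fr {x} x∈ x≢u with ∈-lonely-expand c≤1 fr x∈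
    ... | inj₁ x∈S = ≤-trans (cnt-antitone {S′ = expand G k S p} {x} ∈-expand⁺) (noW2 x∈S)
    ... | inj₂ x≡u = contradiction x≡u x≢u

  module _ {S : State n} {j : ℕ} {p : Fin n} {T : State n} {k : ℕ}
           (p∈ : p ∈V S) (W2 : 2 ≤ cnt G S p) (R : Steps (expand G (suc j) S p) (suc j) T k) where

    W2-fresh-rank : ∀ {y} → Fresh S p y → rank T y ≡ rank T p
    W2-fresh-rank {y} fr = begin
      rank T y                         ≡⟨ steps-rank R (edge⇒∈-expand (proj₁ fr)) ⟩
      rank (expand G (suc j) S p) y    ≡⟨ rank-expand-fresh {k = suc j} fr ⟩
      newRank G S p                    ≡⟨ newRank-W2 W2 ⟩
      rank S p                         ≡⟨ sym (rank-expand-old {k = suc j} p∈) ⟩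
      rank (expand G (suc j) S p) p    ≡⟨ sym (steps-rank R (∈-expand⁺ p∈)) ⟩
      rank T p                         ∎
      where open ≡-Reasoning

    W2-fresh-∉U : ∀ {y} → Fresh S p y → ¬ InU G T y
    W2-fresh-∉U fr y∈U = y∈U p (λ { refl → proj₂ fr p∈ }) (sym (W2-fresh-rank fr))

    W2-∉U : ¬ InU G T p
    W2-∉U p∈U with 1≤cnt⇒fresh (≤-trans (s≤s z≤n) W2)
    ... | y , fr = p∈U y (λ { refl → proj₂ fr p∈ }) (W2-fresh-rank fr)

  deg≤cnt-init : ∀ {a} → deg G a ≤ cnt G (init a) a
  deg≤cnt-init {a} = p⊆q⇒∣p∣≤∣q∣ {p = tabulate (adj G a)} {q = tabulate (new G (init a) a)}
    (λ y∈ → let e = ∈-tabulate⁻ y∈ in ∈-tabulate⁺ (fresh⇒new (e , ≢⇒∉-init (≢-sym (edge⇒≢ e)))))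

  root-∉U : ∀ {a T k x} → 2 ≤ deg G a → Steps (init a) 0 T k → x ∈V T → x ≢ a → ¬ InU G T a
  root-∉U 2≤deg R x∈ x≢a with steps-proceed R (≢⇒∉-init x≢a) x∈
  ... | p , c , R′ with ∈-init⇒≡ (choice-∈ c)
  ...   | refl = W2-∉U (choice-∈ c) (≤-trans 2≤deg deg≤cnt-init) R′

  unique-rank⇒NoW2 : ∀ {S j p T k u} → NoW2Except S u → Choice G S p →
                         Steps (expand G (suc j) S p) (suc j) T k → InU G T u → NoW2 S
  unique-rank⇒NoW2 {S} {p = p} {u = u} noW2 c R u∈U = lonely-choice⇒NoW2 c p-lonely
    where
    p-lonely : cnt G S p ≤ 1
    p-lonely with p ≟ u | 2 ≤? cnt G S p
    ... | no p≢u  | _        = noW2 (choice-∈ c) p≢u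
    ... | yes refl | yes 2≤c = contradiction u∈U (W2-∉U (choice-∈ c) 2≤c R)
    ... | yes refl | no ¬2≤c = ¬2≤⇒≤1 ¬2≤c

  module _ {S : State n} where

    W1-restrict : ∀ {S′ p} → S ⊆V S′ → p ∈V S → cnt G S p ≤ 1 → W1 G S′ p → W1 G S p
    W1-restrict {S′} {p} S⊆S′ p∈ c≤1 (_ , c′≡1 , fresh-splits)
      with 1≤cnt⇒fresh {S = S′} {p} (≤-reflexive (sym c′≡1))
    ... | z , frz′ = inT≡true p∈ , ≤-antisym c≤1 (fresh⇒1≤cnt frz) , splits
      where
      frz : Fresh S p z
      frz = fresh-⊆V S⊆S′ frz′
      splits : ∀ y → new G S p y ≡ true → 2 ≤ cnt G (expand G 0 S p) y
      splits y ny with fresh-unique c≤1 frz (new⇒fresh ny)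
      ... | refl = ≤-trans (fresh-splits z (fresh⇒new frz′))
                           (cnt-antitone {x = z} (expand-⊆V {k = 0} {k′ = 0} {p = p} S⊆S′))

    W0-if-¬W1 : ∀ {p} → p ∈V S → cnt G S p ≡ 1 → ¬ W1 G S p → W0 G S p
    W0-if-¬W1 {p} p∈ c≡1 ¬W1 = inT≡true p∈ , c≡1 , child-lonely
      where
      child-lonely : ∀ v → new G S p v ≡ true → cnt G (expand G 0 S p) v ≤ 1
      child-lonely v nv with 2 ≤? cnt G (expand G 0 S p) v
      ... | no ¬2≤c = ¬2≤⇒≤1 ¬2≤c
      ... | yes 2≤c = contradiction (inT≡true p∈ , c≡1 , splits) ¬W1
        where
        splits : ∀ v′ → new G S p v′ ≡ true → 2 ≤ cnt G (expand G 0 S p) v′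
        splits v′ nv′ with fresh-unique {S = S} {p} (≤-reflexive c≡1) (new⇒fresh nv) (new⇒fresh nv′)
        ... | refl = 2≤c

    two-outside⇒W1 : ∀ {y v u w} → y ∈V S → cnt G S y ≤ 1 → Fresh S y v →
                     Edge G v u → Edge G v w → u ∉V S → w ∉V S → u ≢ v → w ≢ v → u ≢ w → W1 G S y
    two-outside⇒W1 {y} {v} {u} {w} y∈ c≤1 frv vu vw u∉ w∉ u≢v w≢v u≢w =
      inT≡true y∈ , ≤-antisym c≤1 (fresh⇒1≤cnt frv) , splits
      where
      still-out : ∀ {x} → x ∉V S → x ≢ v → x ∉V expand G 0 S y
      still-out x∉ x≢v = ∉-expand x∉ (λ yx → x≢v (fresh-unique c≤1 (yx , x∉) frv))
      splits : ∀ v′ → new G S y v′ ≡ true → 2 ≤ cnt G (expand G 0 S y) v′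
      splits v′ nv′ with fresh-unique c≤1 frv (new⇒fresh nv′)
      ... | refl = fresh≢⇒2≤cnt (vu , still-out u∉ u≢v) (vw , still-out w∉ w≢v) u≢w

  -- W1 speaks about expand G 0, but V(expand G k S p) does not depend on k.
  ¬W1-before-lonely-step : ∀ {S p k u} → Choice G S p → cnt G S p ≤ 1 → Fresh S p u →
                           cnt G (expand G k S p) u ≤ 1 → ¬ ∃ (W1 G S)
  ¬W1-before-lonely-step (inj₁ (_ , 2≤c))               c≤1 _  _    = contradiction 2≤c (≤⇒≯ c≤1)
  ¬W1-before-lonely-step (inj₂ (inj₁ (_ , (_ , _ , splits)))) _ fr u≤1 _ =
    contradiction (splits _ (fresh⇒new fr)) (≤⇒≯ u≤1)
  ¬W1-before-lonely-step (inj₂ (inj₂ (_ , ¬W1 , _)))    _   _  _    = ¬W1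

-- The case of a parent outside W₂

rank-<⇒≢ : ∀ {n} (T : State n) {x y} → rank T x < rank T y → x ≢ y
rank-<⇒≢ T lt x≡y = <⇒≢ lt (cong (rank T) x≡y)

module LonelyBirth
  {n : ℕ} (G : Graph n) {a : Fin n} {T : State n} {k : ℕ} (complete : Complete G T)
  {S₀ : State n} {j₀ : ℕ} {p₀ u : Fin n}
  (R₀ : Run G a S₀ j₀) (c₀ : Choice G S₀ p₀) (lonely₀ : cnt G S₀ p₀ ≤ 1) (u-fresh : Fresh G S₀ p₀ u)
  (R₁ : Steps G (expand G (suc j₀) S₀ p₀) (suc j₀) T k)
  {v w : Fin n} (uv : Edge G u v) (vw : Edge G v w) (u∈U : InU G T u) (v∈U : InU G T v)
  (ru<rv : rank T u < rank T v) (rv<rw : rank T v < rank T w)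
  where

  ∈T : ∀ x → x ∈V T
  ∈T x = mk∈V (complete x)

  u≢v : u ≢ v
  u≢v = rank-<⇒≢ T ru<rv

  v≢w : v ≢ w
  v≢w = rank-<⇒≢ T rv<rw

  u≢w : u ≢ w
  u≢w = rank-<⇒≢ T (<-trans ru<rv rv<rw)

  S₁ : State n
  S₁ = expand G (suc j₀) S₀ p₀

  noW2₀ : NoW2 G S₀
  noW2₀ = lonely-choice⇒NoW2 G c₀ lonely₀

  u∈S₁ : u ∈V S₁
  u∈S₁ = edge⇒∈-expand G (proj₁ u-fresh)

  rank-u : rank T u ≡ suc (maxRank G S₀)
  rank-u = begin
    rank T u           ≡⟨ steps-rank G R₁ u∈S₁ ⟩
    rank S₁ u          ≡⟨ rank-expand-fresh G {k = suc j₀} u-fresh ⟩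
    newRank G S₀ p₀    ≡⟨ newRank-lonely G lonely₀ ⟩
    suc (maxRank G S₀) ∎
    where open ≡-Reasoning

  S₁-rank≤u : ∀ {x} → x ∈V S₁ → rank T x ≤ rank T u
  S₁-rank≤u {x} x∈ with ∈-lonely-expand G lonely₀ u-fresh x∈
  ... | inj₂ refl = ≤-refl
  ... | inj₁ x∈S₀ = begin
    rank T x           ≡⟨ steps-rank G R₁ x∈ ⟩
    rank S₁ x          ≡⟨ rank-expand-old G {k = suc j₀} x∈S₀ ⟩
    rank S₀ x          ≤⟨ rank≤maxRank G x∈S₀ ⟩
    maxRank G S₀       ≤⟨ n≤1+n _ ⟩
    suc (maxRank G S₀) ≡⟨ sym rank-u ⟩
    rank T u           ∎
    where open ≤-Reasoning

  v∉S₁ : v ∉V S₁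
  v∉S₁ v∈ = <⇒≱ ru<rv (S₁-rank≤u v∈)

  w∉S₁ : w ∉V S₁
  w∉S₁ w∈ = <⇒≱ (<-trans ru<rv rv<rw) (S₁-rank≤u w∈)

  next₁ : ∃[ p₁ ] Choice G S₁ p₁ × Steps G (expand G (suc (suc j₀)) S₁ p₁) (suc (suc j₀)) T k
  next₁ = steps-proceed G R₁ v∉S₁ (∈T v)

  p₁ : Fin n
  p₁ = proj₁ next₁

  c₁ : Choice G S₁ p₁
  c₁ = proj₁ (proj₂ next₁)

  R₂′ : Steps G (expand G (suc (suc j₀)) S₁ p₁) (suc (suc j₀)) T k
  R₂′ = proj₂ (proj₂ next₁)

  noW2₁ : NoW2 G S₁
  noW2₁ = unique-rank⇒NoW2 G (lonely-expand⇒NoW2Except G noW2₀ lonely₀ u-fresh) c₁ R₂′ u∈U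

  v-fresh₁ : Fresh G S₁ u v
  v-fresh₁ = uv , v∉S₁

  lonely₁ : cnt G S₁ u ≤ 1
  lonely₁ = noW2₁ u∈S₁

  ¬W1₀ : ¬ ∃ (W1 G S₀)
  ¬W1₀ = ¬W1-before-lonely-step G {k = suc j₀} c₀ lonely₀ u-fresh lonely₁

  p₁≡u : p₁ ≡ u
  p₁≡u with p₁ ≟ u
  ... | yes p₁≡u = p₁≡u
  ... | no p₁≢u = ⊥-elim (not-chosen c₁)
    where
    p₁∈S₀ : p₁ ∈V S₀
    p₁∈S₀ = fromInj₁ (λ p₁≡u → contradiction p₁≡u p₁≢u)
                     (∈-lonely-expand G lonely₀ u-fresh (choice-∈ G c₁))
    not-chosen : ¬ Choice G S₁ p₁
    not-chosen (inj₁ (_ , 2≤c)) = ≤⇒≯ (noW2₁ (choice-∈ G c₁)) 2≤c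
    not-chosen (inj₂ (inj₁ (_ , W1₁))) =
      ¬W1₀ (p₁ , W1-restrict G (∈-expand⁺ G {k = suc j₀}) p₁∈S₀ (noW2₀ p₁∈S₀) W1₁)
    not-chosen (inj₂ (inj₂ (_ , ¬W1₁ , _ , latest))) = 1+n≰n (begin
      suc j₀       ≡⟨ sym (time-expand-fresh G u-fresh) ⟩
      time S₁ u    ≤⟨ latest u u∈W0 ⟩
      time S₁ p₁   ≡⟨ time-expand-old G p₁∈S₀ ⟩
      time S₀ p₁   ≤⟨ time-bound G R₀ p₁∈S₀ ⟩
      j₀           ∎)
      where
      open ≤-Reasoning
      u∈W0 : W0 G S₁ u
      u∈W0 = W0-if-¬W1 G u∈S₁ (≤-antisym lonely₁ (fresh⇒1≤cnt G v-fresh₁)) (λ W1u → ¬W1₁ (u , W1u))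

  S₂ : State n
  S₂ = expand G (suc (suc j₀)) S₁ u

  R₂ : Steps G S₂ (suc (suc j₀)) T k
  R₂ = subst (λ q → Steps G (expand G (suc (suc j₀)) S₁ q) (suc (suc j₀)) T k) p₁≡u R₂′

  w∉S₂ : w ∉V S₂
  w∉S₂ w∈ = [ w∉S₁ , (λ w≡v → v≢w (sym w≡v)) ] (∈-lonely-expand G lonely₁ v-fresh₁ w∈)

  next₂ : ∃[ p₂ ] Choice G S₂ p₂ ×
                  Steps G (expand G (suc (suc (suc j₀))) S₂ p₂) (suc (suc (suc j₀))) T k
  next₂ = steps-proceed G R₂ w∉S₂ (∈T w)

  lonely₂ : cnt G S₂ v ≤ 1
  lonely₂ = unique-rank⇒NoW2 G (lonely-expand⇒NoW2Except G noW2₁ lonely₁ v-fresh₁)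
              (proj₁ (proj₂ next₂)) (proj₂ (proj₂ next₂)) v∈U (edge⇒∈-expand G uv)

  neighbour : ∀ {y} → Edge G v y → y ≡ u ⊎ y ≡ w
  neighbour {y} vy with ∈V-or-∉V {S = S₁} {y}
  ... | inj₂ y∉S₁ = inj₂ (fresh-unique G lonely₂ (vy , y∉S₂) (vw , w∉S₂))
    where
    y∉S₂ : y ∉V S₂
    y∉S₂ = ∉-expand G y∉S₁ (λ uy → edge⇒≢ G vy (sym (fresh-unique G lonely₁ (uy , y∉S₁) v-fresh₁)))
  ... | inj₁ y∈S₁ with ∈-lonely-expand G lonely₀ u-fresh y∈S₁
  ...   | inj₂ y≡u  = inj₁ y≡u
  ...   | inj₁ y∈S₀ = ⊥-elim (¬W1₀ (y , two-outside⇒W1 G y∈S₀ (noW2₀ y∈S₀) (edge-sym G vy , v∉S₀)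
                                       (edge-sym G uv) vw (proj₂ u-fresh) w∉S₀ u≢v (≢-sym v≢w) u≢w))
    where
    v∉S₀ : v ∉V S₀
    v∉S₀ v∈ = v∉S₁ (∈-expand⁺ G v∈)
    w∉S₀ : w ∉V S₀
    w∉S₀ w∈ = w∉S₁ (∈-expand⁺ G w∈)

  deg-v≡2 : deg G v ≡ 2
  deg-v≡2 = deg≡2 G (edge-sym G uv) vw u≢w neighbour

lemma1 : ∀ {n} (G : Graph n) (a : Fin n) → Connected G → 2 ≤ deg G a →
         ∀ {T : State n} {k : ℕ} → Run G a T k → Complete G T →
         ∀ (u v w : Fin n) → Edge G u v → Edge G v w →
         InU G T u → InU G T v →
         rank T u < rank T v → rank T v < rank T w →
         deg G v ≡ 2
-- Connectedness only serves termination, which Complete already provides.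
lemma1 G a _ 2≤deg {T} R complete u v w uv vw u∈U v∈U ru<rv rv<rw
  with born G R (mk∈V (complete u))
... | inj₁ refl =
  ⊥-elim (root-∉U G 2≤deg (run⇒steps G R) (mk∈V (complete v)) (≢-sym (rank-<⇒≢ T ru<rv)) u∈U)
... | inj₂ (birth {S₀} p₀ R₀ c₀ u-fresh R₁) with 2 ≤? cnt G S₀ p₀
...   | yes W2 = ⊥-elim (W2-fresh-∉U G (choice-∈ G c₀) W2 R₁ u-fresh u∈U)
...   | no ¬W2 =
  LonelyBirth.deg-v≡2 G complete R₀ c₀ (¬2≤⇒≤1 ¬W2) u-fresh R₁ uv vw u∈U v∈U ru<rv rv<rw
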